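{- Let $\sigma,\omega\in S_\infty$ with $\sigma<_{\mathrm{Bruhat}}\omega$. Then $(d(\sigma,\omega),m(\sigma,\omega))$ is the lexicographically first relative candidate for $\sigma,\omega$; that is, it is a relative candidate and $(d(\sigma,\omega),m(\sigma,\omega))<_{\mathrm{lex}}(p,q)$ for every other relative candidate $(p,q)$ for $\sigma,\omega$.
   Context: $S_\infty$ is the group of bijections $\mathbb N\to\mathbb N$, with the Bruhat order: $\sigma\le_{\mathrm{Bruhat}}\omega$ iff for every $n$, the $i$-th smallest element of $\{\sigma(1),\dots,\sigma(n)\}$ is at most the $i$-th smallest of $\{\omega(1),\dots,\omega(n)\}$ for all $i$; $\lessdot_{\mathrm{Bruhat}}$ is the cover relation. Transpositions are written $(p,q)$ with $p<q$; $(p,q)<_{\mathrm{lex}}(p',q')$ iff $p<p'$, or $p=p'$ and $q<q'$. For $\sigma\ne\omega$, $d(\sigma,\omega)$ is the least $n$ with $\sigma(n)\ne\omega(n)$. When $\sigma<_{\mathrm{Bruhat}}\omega$, with $d=d(\sigma,\omega)$ one has $\sigma(d)<\omega(d)$; set $f(\sigma,\omega)=\sigma^{ -1}(\omega(d))$ and let $m(\sigma,\omega)$ be the least $m$ with $d<m\le f$ and $\sigma(d)<\sigma(m)\le\sigma(f)$. A transposition $(p,q)$ is a relative candidate for $\sigma,\omega$ if $\sigma\lessdot_{\mathrm{Bruhat}}\sigma\circ(p,q)\le_{\mathrm{Bruhat}}\omega$. -}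

module Defs where

open import Data.Nat using (ℕ; _≤_; _<_; _≟_)
open import Data.Nat.Properties using (≤-decTotalOrder)
open import Data.List using (List; map; upTo)
open import Data.List.Relation.Binary.Pointwise using (Pointwise)
open import Data.Product using (Σ; _×_; _,_)
open import Data.Sum using (_⊎_)
open import Relation.Nullary using (¬_; yes; no)
open import Relation.Binary.PropositionalEquality using (_≡_)
open import Function using (_∘_)
open import Function.Bundles using (_↔_; Inverse)
import Data.List.Sort as Sort
open Sort ≤-decTotalOrder using (sort)

-- Convention: ℕ = {0,1,2,...}; positions 1,2,3,... of the paper are 0,1,2,...
-- S∞ : bijections ℕ → ℕ (library notion of a bijection/inverse pair)
S∞ : Set
S∞ = ℕ ↔ ℕ

fun : S∞ → ℕ → ℕ
fun = Inverse.to

inv : S∞ → ℕ → ℕ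
inv = Inverse.from

prefixSorted : (ℕ → ℕ) → ℕ → List ℕ
prefixSorted σ n = sort (map σ (upTo n))

_≤B_ : (ℕ → ℕ) → (ℕ → ℕ) → Set
σ ≤B ω = ∀ n → Pointwise _≤_ (prefixSorted σ n) (prefixSorted ω n)

_≠_ : (ℕ → ℕ) → (ℕ → ℕ) → Set
σ ≠ ω = ¬ (∀ n → σ n ≡ ω n)

_<B_ : (ℕ → ℕ) → (ℕ → ℕ) → Set
σ <B ω = σ ≤B ω × σ ≠ ω

_⋖B_ : (ℕ → ℕ) → (ℕ → ℕ) → Set
σ ⋖B τ = σ <B τ × (∀ (ρ : S∞) → ¬ (σ <B fun ρ × fun ρ <B τ))

transp : ℕ → ℕ → ℕ → ℕ
transp p q i with i ≟ p
... | yes _ = q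
... | no _ with i ≟ q
...   | yes _ = p
...   | no _ = i

_<lex_ : ℕ × ℕ → ℕ × ℕ → Set
(p , q) <lex (p' , q') = p < p' ⊎ (p ≡ p' × q < q')

IsD : S∞ → S∞ → ℕ → Set
IsD σ ω d = ¬ (fun σ d ≡ fun ω d) × (∀ n → n < d → fun σ n ≡ fun ω n)

fOf : S∞ → S∞ → ℕ → ℕ
fOf σ ω d = inv σ (fun ω d)

MCond : S∞ → ℕ → ℕ → ℕ → Set
MCond σ d f m = (d < m × m ≤ f) × (fun σ d < fun σ m × fun σ m ≤ fun σ f)

IsM : S∞ → S∞ → ℕ → ℕ → Set
IsM σ ω d m = MCond σ d (fOf σ ω d) m
            × (∀ k → MCond σ d (fOf σ ω d) k → m ≤ k)

RelCand : S∞ → S∞ → ℕ → ℕ → Set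
RelCand σ ω p q = p < q × (fun σ ⋖B (fun σ ∘ transp p q)) × ((fun σ ∘ transp p q) ≤B fun ω)

-- Let rank π n x count the i < n with π i ≤ x. Comparing sorted prefixes pointwise is the
-- same as comparing these counts, so σ ≤B ω iff rank ω ≤ rank σ everywhere. For d < m with
-- σ d < σ m, the ranks of σ ∘ (d m) are those of σ lowered by one exactly on the rectangle
-- (d, m] × [σ d, σ m). Minimality of m says that no σ i with d < i < m lies in [σ d, ω d].
-- Hence a permutation squeezed between σ and σ ∘ (d m) has the ranks of σ off the rectangle,
-- so agrees with σ off {d, m} and is one of the two: (d, m) gives a cover. At a point (n, x)
-- of the rectangle the rank of ω is still strictly below that of σ, since ω puts the value
-- ω d ∈ (x, ω d] at position d while σ puts no value of (x, ω d] at positions d, …, n - 1;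
-- so σ ∘ (d m) ≤ ω. Conversely every candidate (p, q) has σ p < σ q ≤ ω p, which forces
-- p ≥ d, and for p = d says that q satisfies the conditions that define m.

module Submission where

open import Defs
open import Data.Nat using (ℕ; zero; suc; _+_; _∸_; _≤_; _<_; z≤n; s≤s⁻¹; _≟_; _≤?_; _<?_)
open import Data.Nat.Properties
open import Data.Nat.ListAction using (sum)
open import Data.Nat.ListAction.Properties using (sum-++; sum-↭)
open import Algebra.Properties.CommutativeSemigroup +-commutativeSemigroup using (interchange; xy∙z≈xz∙y)
open import Data.List using (List; []; _∷_; map; upTo; length; _∷ʳ_)
open import Data.List.Properties using (upTo-∷ʳ; map-++; map-∘; length-map; length-upTo)
open import Data.List.Relation.Binary.Pointwise using (Pointwise; []; _∷_)
open import Data.List.Relation.Binary.Permutation.Propositional using (_↭_)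
open import Data.List.Relation.Binary.Permutation.Propositional.Properties using (map⁺; ↭-length)
open import Data.List.Relation.Unary.All using (All; []; _∷_)
import Data.List.Relation.Unary.All as All
open import Data.List.Relation.Unary.AllPairs using (AllPairs; []; _∷_)
open import Data.List.Relation.Unary.Sorted.TotalOrder.Properties using (Sorted⇒AllPairs)
import Data.List.Sort as Sort
open Sort ≤-decTotalOrder using (sort-↭; sort-↗)
open import Data.Product using (Σ; _×_; _,_; proj₁; proj₂)
open import Data.Sum using (_⊎_; inj₁; inj₂; [_,_]′)
import Data.Sum as Sum
open import Data.Empty using (⊥-elim)
open import Function using (_∘_; id)
open import Function.Bundles using (Inverse; Injection)
open import Function.Properties.Inverse using (Inverse⇒Injection)
open import Relation.Nullary using (¬_; yes; no; contradiction)
open import Relation.Nullary.Decidable using (_×-dec_)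
open import Relation.Unary using (Pred; Decidable)
open import Relation.Binary.Definitions using (tri<; tri≈; tri>)
open import Relation.Binary.PropositionalEquality
  using (_≡_; _≢_; ≢-sym; _≗_; refl; sym; trans; cong; cong₂; subst; subst₂; module ≡-Reasoning)

⟦_≤_⟧ : ℕ → ℕ → ℕ
⟦ a ≤ x ⟧ with a ≤? x
... | yes _ = 1
... | no  _ = 0

⟦≤⟧-yes : ∀ {a x} → a ≤ x → ⟦ a ≤ x ⟧ ≡ 1
⟦≤⟧-yes {a} {x} a≤x with a ≤? x
... | yes _   = refl
... | no a≰x = contradiction a≤x a≰x

⟦≤⟧-no : ∀ {a x} → x < a → ⟦ a ≤ x ⟧ ≡ 0
⟦≤⟧-no {a} {x} x<a with a ≤? x
... | yes a≤x = contradiction a≤x (<⇒≱ x<a)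
... | no _    = refl

⟦≤⟧≤1 : ∀ a x → ⟦ a ≤ x ⟧ ≤ 1
⟦≤⟧≤1 a x with a ≤? x
... | yes _ = ≤-refl
... | no  _ = z≤n

⟦≤⟧≡1⇒≤ : ∀ {a x} → ⟦ a ≤ x ⟧ ≡ 1 → a ≤ x
⟦≤⟧≡1⇒≤ {a} {x} eq with a ≤? x
⟦≤⟧≡1⇒≤ eq  | yes a≤x = a≤x
⟦≤⟧≡1⇒≤ () | no _

⟦≤⟧≡0⇒> : ∀ {a x} → ⟦ a ≤ x ⟧ ≡ 0 → x < a
⟦≤⟧≡0⇒> {a} {x} eq with a ≤? x
⟦≤⟧≡0⇒> () | yes _
⟦≤⟧≡0⇒> eq  | no a≰x = ≰⇒> a≰x

⟦≤⟧-antitone : ∀ {a b} x → a ≤ b → ⟦ b ≤ x ⟧ ≤ ⟦ a ≤ x ⟧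
⟦≤⟧-antitone {a} {b} x a≤b with b ≤? x
... | yes b≤x = ≤-reflexive (sym (⟦≤⟧-yes (≤-trans a≤b b≤x)))
... | no  _   = z≤n

⟦≤⟧-monotone : ∀ a {x y} → x ≤ y → ⟦ a ≤ x ⟧ ≤ ⟦ a ≤ y ⟧
⟦≤⟧-monotone a {x} x≤y with a ≤? x
... | yes a≤x = ≤-reflexive (sym (⟦≤⟧-yes (≤-trans a≤x x≤y)))
... | no  _   = z≤n

⟦≤⟧-off-interval : ∀ {a b x} → a ≤ b → x < a ⊎ b ≤ x → ⟦ a ≤ x ⟧ ≡ ⟦ b ≤ x ⟧
⟦≤⟧-off-interval a≤b (inj₁ x<a) = trans (⟦≤⟧-no x<a) (sym (⟦≤⟧-no (<-≤-trans x<a a≤b)))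
⟦≤⟧-off-interval a≤b (inj₂ b≤x) = trans (⟦≤⟧-yes (≤-trans a≤b b≤x)) (sym (⟦≤⟧-yes b≤x))

⟦≤⟧-agree⇒≤ : ∀ {a b} → ⟦ a ≤ b ⟧ ≡ ⟦ b ≤ b ⟧ → a ≤ b
⟦≤⟧-agree⇒≤ eq = ⟦≤⟧≡1⇒≤ (trans eq (⟦≤⟧-yes ≤-refl))

⟦≤⟧-injective : ∀ {a b} → ⟦ a ≤ a ⟧ ≡ ⟦ b ≤ a ⟧ → ⟦ a ≤ b ⟧ ≡ ⟦ b ≤ b ⟧ → a ≡ b
⟦≤⟧-injective atA atB = ≤-antisym (⟦≤⟧-agree⇒≤ atB) (⟦≤⟧-agree⇒≤ (sym atA))

⟦≤⟧-injective-everywhere : ∀ {a b} → (∀ x → ⟦ a ≤ x ⟧ ≡ ⟦ b ≤ x ⟧) → a ≡ b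
⟦≤⟧-injective-everywhere {a} {b} agree = ⟦≤⟧-injective (agree a) (agree b)

⟦≤⟧-injective-off-interval : ∀ {lo hi a b} → (∀ x → x < lo ⊎ hi ≤ x → ⟦ a ≤ x ⟧ ≡ ⟦ b ≤ x ⟧) →
                             b < lo ⊎ hi < b → a ≡ b
⟦≤⟧-injective-off-interval {a = a} {b} agree (inj₁ b<lo) = ⟦≤⟧-injective (agree a (inj₁ a<lo)) atB
  where
  atB = agree b (inj₁ b<lo)
  a<lo = ≤-<-trans (⟦≤⟧-agree⇒≤ atB) b<lo
⟦≤⟧-injective-off-interval {hi = hi} {a} {b} agree (inj₂ hi<b) =
  ⟦≤⟧-injective (agree a (inj₂ (<⇒≤ hi<a))) (agree b (inj₂ (<⇒≤ hi<b)))
  where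
  hi<a : hi < a
  hi<a = ⟦≤⟧≡0⇒> (trans (agree hi (inj₂ ≤-refl)) (⟦≤⟧-no hi<b))

⟦_∈⟨_,_]⟧ : ℕ → ℕ → ℕ → ℕ
⟦ a ∈⟨ x , y ]⟧ = ⟦ a ≤ y ⟧ ∸ ⟦ a ≤ x ⟧

⟦∈⟨,]⟧-yes : ∀ {x a y} → x < a → a ≤ y → ⟦ a ∈⟨ x , y ]⟧ ≡ 1
⟦∈⟨,]⟧-yes x<a a≤y = cong₂ _∸_ (⟦≤⟧-yes a≤y) (⟦≤⟧-no x<a)

⟦∈⟨,]⟧-no : ∀ {x a y} → a ≤ x ⊎ y < a → ⟦ a ∈⟨ x , y ]⟧ ≡ 0
⟦∈⟨,]⟧-no {x} {a} {y} (inj₁ a≤x) = trans (cong (⟦ a ≤ y ⟧ ∸_) (⟦≤⟧-yes a≤x)) (m≤n⇒m∸n≡0 (⟦≤⟧≤1 a y))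
⟦∈⟨,]⟧-no {x} {a} {y} (inj₂ y<a) = trans (cong (_∸ ⟦ a ≤ x ⟧) (⟦≤⟧-no y<a)) (0∸n≡0 ⟦ a ≤ x ⟧)

⟦≤⟧-split : ∀ a {x y} → x ≤ y → ⟦ a ≤ x ⟧ + ⟦ a ∈⟨ x , y ]⟧ ≡ ⟦ a ≤ y ⟧
⟦≤⟧-split a x≤y = m+[n∸m]≡n (⟦≤⟧-monotone a x≤y)

∑< : ℕ → (ℕ → ℕ) → ℕ
∑< zero    f = 0
∑< (suc n) f = ∑< n f + f n

syntax ∑< n (λ i → e) = ∑[ i < n ] e

∑<-cong : ∀ n {f g} → (∀ i → i < n → f i ≡ g i) → ∑< n f ≡ ∑< n g
∑<-cong zero    eq = refl
∑<-cong (suc n) eq = cong₂ _+_ (∑<-cong n (λ i i<n → eq i (m<n⇒m<1+n i<n))) (eq n ≤-refl)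

∑<-distrib-+ : ∀ n f g → ∑[ i < n ] (f i + g i) ≡ ∑< n f + ∑< n g
∑<-distrib-+ zero    f g = refl
∑<-distrib-+ (suc n) f g =
  trans (cong (_+ (f n + g n)) (∑<-distrib-+ n f g)) (interchange (∑< n f) (∑< n g) (f n) (g n))

∑<-mono-bound : ∀ f {n n′} → n ≤ n′ → ∑< n f ≤ ∑< n′ f
∑<-mono-bound f {n′ = zero}   z≤n = ≤-refl
∑<-mono-bound f {n′ = suc n′} n≤1+n′ with m≤n⇒m<n∨m≡n n≤1+n′
... | inj₁ n<1+n′ = ≤-trans (∑<-mono-bound f (s≤s⁻¹ n<1+n′)) (m≤m+n _ _)
... | inj₂ refl   = ≤-refl

∑<-vanishing-tail : ∀ f {d n} → d ≤ n → (∀ i → d ≤ i → i < n → f i ≡ 0) → ∑< n f ≡ ∑< d f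
∑<-vanishing-tail f {n = zero}  z≤n    _      = refl
∑<-vanishing-tail f {d} {suc n} d≤1+n vanish with m≤n⇒m<n∨m≡n d≤1+n
... | inj₂ refl  = refl
... | inj₁ d<1+n = begin
  ∑< n f + f n  ≡⟨ cong₂ _+_ (∑<-vanishing-tail f d≤n (λ i d≤i i<n → vanish i d≤i (m<n⇒m<1+n i<n)))
                             (vanish n d≤n ≤-refl) ⟩
  ∑< d f + 0    ≡⟨ +-identityʳ _ ⟩
  ∑< d f        ∎
  where
  open ≡-Reasoning
  d≤n = s≤s⁻¹ d<1+n

sum-map-upTo : ∀ f n → sum (map f (upTo n)) ≡ ∑< n f
sum-map-upTo f zero    = refl
sum-map-upTo f (suc n) = begin
  sum (map f (upTo (suc n)))            ≡⟨ cong (sum ∘ map f) (sym (upTo-∷ʳ n)) ⟩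
  sum (map f (upTo n ∷ʳ n))             ≡⟨ cong sum (map-++ f (upTo n) (n ∷ [])) ⟩
  sum (map f (upTo n) ∷ʳ f n)           ≡⟨ sum-++ (map f (upTo n)) (f n ∷ []) ⟩
  sum (map f (upTo n)) + (f n + 0)      ≡⟨ cong₂ _+_ (sum-map-upTo f n) (+-identityʳ (f n)) ⟩
  ∑< n f + f n                          ∎
  where open ≡-Reasoning

rank : (ℕ → ℕ) → ℕ → ℕ → ℕ
rank σ n x = ∑[ i < n ] ⟦ σ i ≤ x ⟧

rank-cong : ∀ {σ τ} n {x} → (∀ i → i < n → σ i ≡ τ i) → rank σ n x ≡ rank τ n x
rank-cong n {x} agree = ∑<-cong n (λ i i<n → cong ⟦_≤ x ⟧ (agree i i<n))

rank-split : ∀ σ n {x y} → x ≤ y → rank σ n x + ∑[ i < n ] ⟦ σ i ∈⟨ x , y ]⟧ ≡ rank σ n y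
rank-split σ n x≤y = trans (sym (∑<-distrib-+ n _ _)) (∑<-cong n (λ i _ → ⟦≤⟧-split (σ i) x≤y))

count≤ : ℕ → List ℕ → ℕ
count≤ x xs = sum (map ⟦_≤ x ⟧ xs)

count≤-↭ : ∀ x {xs ys} → xs ↭ ys → count≤ x xs ≡ count≤ x ys
count≤-↭ x p = sum-↭ (map⁺ ⟦_≤ x ⟧ p)

count≤-all> : ∀ {x xs} → All (x <_) xs → count≤ x xs ≡ 0
count≤-all> []           = refl
count≤-all> (x<a ∷ x<xs) = cong₂ _+_ (⟦≤⟧-no x<a) (count≤-all> x<xs)

count≤-antitone : ∀ x {xs ys} → Pointwise _≤_ xs ys → count≤ x ys ≤ count≤ x xs
count≤-antitone x []          = z≤n
count≤-antitone x (a≤b ∷ xs≤ys) = +-mono-≤ (⟦≤⟧-antitone x a≤b) (count≤-antitone x xs≤ys)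

count≤⇒pointwise : ∀ {xs ys} → AllPairs _≤_ xs → AllPairs _≤_ ys → length xs ≡ length ys →
                   (∀ x → count≤ x ys ≤ count≤ x xs) → Pointwise _≤_ xs ys
count≤⇒pointwise []            []            _   _      = []
count≤⇒pointwise {a ∷ xs} {b ∷ ys} (a≤xs ∷ xs↗) (b≤ys ∷ ys↗) len counts =
  a≤b ∷ count≤⇒pointwise xs↗ ys↗ (suc-injective len) tail-counts
  where
  -- at x = b the right-hand side would be 0 while the left-hand side is positive
  a≤b : a ≤ b
  a≤b = ≮⇒≥ λ b<a → contradiction
    (subst₂ _≤_ (cong (_+ count≤ b ys) (⟦≤⟧-yes ≤-refl))
                (count≤-all> (b<a ∷ All.map (<-≤-trans b<a) a≤xs)) (counts b))
    λ ()
  tail-counts : ∀ x → count≤ x ys ≤ count≤ x xs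
  tail-counts x with b ≤? x
  ... | no b≰x  = subst (_≤ count≤ x xs)
                        (sym (count≤-all> (All.map (<-≤-trans (≰⇒> b≰x)) b≤ys))) z≤n
  ... | yes b≤x = +-cancelˡ-≤ 1 _ _
    (subst₂ _≤_ (cong (_+ count≤ x ys) (⟦≤⟧-yes b≤x))
                (cong (_+ count≤ x xs) (⟦≤⟧-yes (≤-trans a≤b b≤x))) (counts x))

count≤-prefixSorted : ∀ σ n x → count≤ x (prefixSorted σ n) ≡ rank σ n x
count≤-prefixSorted σ n x = begin
  count≤ x (prefixSorted σ n)          ≡⟨ count≤-↭ x (sort-↭ _) ⟩
  sum (map ⟦_≤ x ⟧ (map σ (upTo n)))   ≡⟨ cong sum (sym (map-∘ (upTo n))) ⟩
  sum (map (⟦_≤ x ⟧ ∘ σ) (upTo n))     ≡⟨ sum-map-upTo _ n ⟩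
  rank σ n x                           ∎
  where open ≡-Reasoning

length-prefixSorted : ∀ σ n → length (prefixSorted σ n) ≡ n
length-prefixSorted σ n = trans (↭-length (sort-↭ _)) (trans (length-map σ (upTo n)) (length-upTo n))

≤B⇒rank≥ : ∀ {σ ω} → σ ≤B ω → ∀ n x → rank ω n x ≤ rank σ n x
≤B⇒rank≥ {σ} {ω} σ≤ω n x =
  subst₂ _≤_ (count≤-prefixSorted ω n x) (count≤-prefixSorted σ n x) (count≤-antitone x (σ≤ω n))

rank≥⇒≤B : ∀ {σ ω} → (∀ n x → rank ω n x ≤ rank σ n x) → σ ≤B ω
rank≥⇒≤B {σ} {ω} ranks n =
  count≤⇒pointwise (sorted σ) (sorted ω)
    (trans (length-prefixSorted σ n) (sym (length-prefixSorted ω n)))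
    (λ x → subst₂ _≤_ (sym (count≤-prefixSorted ω n x)) (sym (count≤-prefixSorted σ n x)) (ranks n x))
  where
  sorted : ∀ π → AllPairs _≤_ (prefixSorted π n)
  sorted π = Sorted⇒AllPairs ≤-totalOrder (sort-↗ _)

≤B-agree⇒≤ : ∀ {σ ω} → σ ≤B ω → ∀ p → (∀ i → i < p → σ i ≡ ω i) → σ p ≤ ω p
≤B-agree⇒≤ {σ} {ω} σ≤ω p agree =
  ⟦≤⟧≡1⇒≤ (≤-antisym (⟦≤⟧≤1 (σ p) (ω p)) (+-cancelˡ-≤ (rank ω p (ω p)) 1 _ ranks))
  where
  ranks : rank ω p (ω p) + 1 ≤ rank ω p (ω p) + ⟦ σ p ≤ ω p ⟧
  ranks = subst₂ _≤_ (cong (rank ω p (ω p) +_) (⟦≤⟧-yes ≤-refl))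
                     (cong (_+ ⟦ σ p ≤ ω p ⟧) (rank-cong p agree))
                     (≤B⇒rank≥ σ≤ω (suc p) (ω p))

transp-fst : ∀ p q → transp p q p ≡ q
transp-fst p q with p ≟ p
... | yes _   = refl
... | no p≢p = contradiction refl p≢p

transp-snd : ∀ {p q} → p ≢ q → transp p q q ≡ p
transp-snd {p} {q} p≢q with q ≟ p
... | yes q≡p = contradiction (sym q≡p) p≢q
... | no _ with q ≟ q
...   | yes _   = refl
...   | no q≢q = contradiction refl q≢q

transp-fix : ∀ {p q i} → i ≢ p → i ≢ q → transp p q i ≡ i
transp-fix {p} {q} {i} i≢p i≢q with i ≟ p
... | yes i≡p = contradiction i≡p i≢p
... | no _ with i ≟ q
...   | yes i≡q = contradiction i≡q i≢q
...   | no _    = refl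

transp-fix-below : ∀ {p q i} → p < q → i < p → transp p q i ≡ i
transp-fix-below p<q i<p = transp-fix (<⇒≢ i<p) (<⇒≢ (<-trans i<p p<q))

-- The rectangle (d, m] × [σ d, σ m) on which, when σ d < σ m, the rank of σ ∘ transp d m is one less.
Inside Outside : (ℕ → ℕ) → ℕ → ℕ → ℕ → ℕ → Set
Inside  σ d m n x = (d < n × n ≤ m) × (σ d ≤ x × x < σ m)
Outside σ d m n x = (n ≤ d ⊎ m < n) ⊎ (x < σ d ⊎ σ m ≤ x)

inside-or-outside : ∀ σ d m n x → Inside σ d m n x ⊎ Outside σ d m n x
inside-or-outside σ d m n x with n ≤? d | m <? n | x <? σ d | σ m ≤? x
... | yes n≤d | _       | _        | _        = inj₂ (inj₁ (inj₁ n≤d))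
... | no _    | yes m<n | _        | _        = inj₂ (inj₁ (inj₂ m<n))
... | no _    | no _    | yes x<σd | _        = inj₂ (inj₂ (inj₁ x<σd))
... | no _    | no _    | no _     | yes σm≤x = inj₂ (inj₂ (inj₂ σm≤x))
... | no n≰d  | no m≮n  | no x≮σd  | no σm≰x  = inj₁ ((≰⇒> n≰d , ≮⇒≥ m≮n) , (≮⇒≥ x≮σd , ≰⇒> σm≰x))

module _ (σ : ℕ → ℕ) {d m : ℕ} (d<m : d < m) where

  private
    τ : ℕ → ℕ
    τ = σ ∘ transp d m

  rank-transp-below : ∀ {n x} → n ≤ d → rank (σ ∘ transp d m) n x ≡ rank σ n x
  rank-transp-below {n} n≤d = rank-cong n λ i i<n → cong σ (transp-fix-below d<m (<-≤-trans i<n n≤d))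

  rank-transp-between : ∀ {n x} → d < n → n ≤ m →
                        rank (σ ∘ transp d m) n x + ⟦ σ d ≤ x ⟧ ≡ rank σ n x + ⟦ σ m ≤ x ⟧
  rank-transp-between {suc n} {x} d<1+n 1+n≤m with m≤n⇒m<n∨m≡n (s≤s⁻¹ d<1+n)
  ... | inj₂ refl = begin
    rank τ d x + ⟦ τ d ≤ x ⟧ + ⟦ σ d ≤ x ⟧  ≡⟨ cong₂ (λ r v → r + ⟦ v ≤ x ⟧ + ⟦ σ d ≤ x ⟧)
                                                    (rank-transp-below ≤-refl) (cong σ (transp-fst d m)) ⟩
    rank σ d x + ⟦ σ m ≤ x ⟧ + ⟦ σ d ≤ x ⟧  ≡⟨ xy∙z≈xz∙y (rank σ d x) _ _ ⟩
    rank σ d x + ⟦ σ d ≤ x ⟧ + ⟦ σ m ≤ x ⟧  ∎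
    where open ≡-Reasoning
  ... | inj₁ d<n = begin
    rank τ n x + ⟦ τ n ≤ x ⟧ + ⟦ σ d ≤ x ⟧  ≡⟨ xy∙z≈xz∙y (rank τ n x) ⟦ τ n ≤ x ⟧ _ ⟩
    rank τ n x + ⟦ σ d ≤ x ⟧ + ⟦ τ n ≤ x ⟧  ≡⟨ cong₂ _+_ (rank-transp-between d<n (<⇒≤ 1+n≤m))
                                                       (cong (λ v → ⟦ σ v ≤ x ⟧) (transp-fix n≢d n≢m)) ⟩
    rank σ n x + ⟦ σ m ≤ x ⟧ + ⟦ σ n ≤ x ⟧  ≡⟨ xy∙z≈xz∙y (rank σ n x) ⟦ σ m ≤ x ⟧ _ ⟩
    rank σ n x + ⟦ σ n ≤ x ⟧ + ⟦ σ m ≤ x ⟧  ∎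
    where
    open ≡-Reasoning
    n≢d = ≢-sym (<⇒≢ d<n)
    n≢m = <⇒≢ 1+n≤m

  rank-transp-above : ∀ {n x} → m < n → rank (σ ∘ transp d m) n x ≡ rank σ n x
  rank-transp-above {suc n} {x} m<1+n with m≤n⇒m<n∨m≡n (s≤s⁻¹ m<1+n)
  ... | inj₂ refl = trans (cong (λ v → rank τ m x + ⟦ σ v ≤ x ⟧) (transp-snd (<⇒≢ d<m)))
                          (rank-transp-between d<m ≤-refl)
  ... | inj₁ m<n  = cong₂ _+_ (rank-transp-above m<n)
                              (cong (λ v → ⟦ σ v ≤ x ⟧) (transp-fix n≢d (≢-sym (<⇒≢ m<n))))
    where n≢d = ≢-sym (<⇒≢ (<-trans d<m m<n))

  rank-transp-inside : ∀ {n x} → Inside σ d m n x → suc (rank (σ ∘ transp d m) n x) ≡ rank σ n x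
  rank-transp-inside {n} {x} ((d<n , n≤m) , (σd≤x , x<σm)) = begin
    suc (rank τ n x)                      ≡⟨ +-comm 1 _ ⟩
    rank τ n x + 1                        ≡⟨ cong (rank τ n x +_) (sym (⟦≤⟧-yes σd≤x)) ⟩
    rank τ n x + ⟦ σ d ≤ x ⟧              ≡⟨ rank-transp-between d<n n≤m ⟩
    rank σ n x + ⟦ σ m ≤ x ⟧              ≡⟨ cong (rank σ n x +_) (⟦≤⟧-no x<σm) ⟩
    rank σ n x + 0                        ≡⟨ +-identityʳ _ ⟩
    rank σ n x                            ∎
    where open ≡-Reasoning

module _ (σ : ℕ → ℕ) {d m : ℕ} (d<m : d < m) (σd≤σm : σ d ≤ σ m) where

  private
    τ : ℕ → ℕ
    τ = σ ∘ transp d m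

  rank-transp-outside : ∀ {n x} → Outside σ d m n x → rank (σ ∘ transp d m) n x ≡ rank σ n x
  rank-transp-outside (inj₁ (inj₁ n≤d)) = rank-transp-below σ d<m n≤d
  rank-transp-outside (inj₁ (inj₂ m<n)) = rank-transp-above σ d<m m<n
  rank-transp-outside {n} {x} (inj₂ x-off) with n ≤? d | m <? n
  ... | yes n≤d | _       = rank-transp-below σ d<m n≤d
  ... | no _    | yes m<n = rank-transp-above σ d<m m<n
  ... | no n≰d  | no m≮n  = +-cancelʳ-≡ ⟦ σ d ≤ x ⟧ _ _
    (trans (rank-transp-between σ d<m (≰⇒> n≰d) (≮⇒≥ m≮n))
           (cong (rank σ n x +_) (sym (⟦≤⟧-off-interval σd≤σm x-off))))

  rank-transp-≤ : ∀ n x → rank (σ ∘ transp d m) n x ≤ rank σ n x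
  rank-transp-≤ n x with inside-or-outside σ d m n x
  ... | inj₁ inside  = subst (rank τ n x ≤_) (rank-transp-inside σ d<m inside) (n≤1+n _)
  ... | inj₂ outside = ≤-reflexive (rank-transp-outside outside)

transp-<B : ∀ σ {d m} → d < m → σ d < σ m → σ <B (σ ∘ transp d m)
transp-<B σ {d} {m} d<m σd<σm =
  rank≥⇒≤B (rank-transp-≤ σ d<m (<⇒≤ σd<σm)) ,
  λ σ≗τ → <⇒≢ σd<σm (trans (σ≗τ d) (cong σ (transp-fst d m)))

AgreeOff : (ℕ → ℕ) → (ℕ → ℕ) → ℕ → ℕ → Set
AgreeOff ρ σ d m = ∀ i → i ≢ d → i ≢ m → ρ i ≡ σ i

module _ {σ ρ : ℕ → ℕ} {d m : ℕ} (d<m : d < m) (σd<σm : σ d < σ m)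
         (σ≤ρ : σ ≤B ρ) (ρ≤τ : ρ ≤B (σ ∘ transp d m)) where

  private
    squeezed-rank : ∀ {n x} → Outside σ d m n x → rank ρ n x ≡ rank σ n x
    squeezed-rank {n} {x} outside =
      ≤-antisym (≤B⇒rank≥ σ≤ρ n x)
                (subst (_≤ rank ρ n x) (rank-transp-outside σ d<m (<⇒≤ σd<σm) outside) (≤B⇒rank≥ ρ≤τ n x))

    squeezed-value : ∀ {i x} → Outside σ d m i x → Outside σ d m (suc i) x → ⟦ ρ i ≤ x ⟧ ≡ ⟦ σ i ≤ x ⟧
    squeezed-value {i} {x} outside outside′ =
      +-cancelˡ-≡ (rank σ i x) _ _ (trans (cong (_+ ⟦ ρ i ≤ x ⟧) (sym (squeezed-rank outside)))
                                          (squeezed-rank outside′))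

  squeezed⇒AgreeOff : (∀ i → d < i → i < m → σ i < σ d ⊎ σ m < σ i) → AgreeOff ρ σ d m
  squeezed⇒AgreeOff gap i i≢d i≢m with <-cmp i d | <-cmp i m
  ... | tri≈ _ i≡d _ | _            = contradiction i≡d i≢d
  ... | _            | tri≈ _ i≡m _ = contradiction i≡m i≢m
  ... | tri< i<d _ _ | _            = ⟦≤⟧-injective-everywhere λ x →
    squeezed-value (inj₁ (inj₁ (<⇒≤ i<d))) (inj₁ (inj₁ i<d))
  ... | _            | tri> _ _ m<i = ⟦≤⟧-injective-everywhere λ x →
    squeezed-value (inj₁ (inj₂ m<i)) (inj₁ (inj₂ (m<n⇒m<1+n m<i)))
  ... | tri> _ _ d<i | tri< i<m _ _ = ⟦≤⟧-injective-off-interval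
    (λ x x-off → squeezed-value (inj₂ x-off) (inj₂ x-off)) (gap i d<i i<m)

AgreeOff⇒≗ : ∀ {ρ π d m} → AgreeOff ρ π d m → ρ d ≡ π d → ρ m ≡ π m → ρ ≗ π
AgreeOff⇒≗ {d = d} {m} agree ρd≡πd ρm≡πm i with i ≟ d | i ≟ m
... | yes refl | _        = ρd≡πd
... | no _     | yes refl = ρm≡πm
... | no i≢d   | no i≢m   = agree i i≢d i≢m

AgreeOff-transp : ∀ {ρ σ d m} → AgreeOff ρ σ d m → AgreeOff ρ (σ ∘ transp d m) d m
AgreeOff-transp {σ = σ} agree i i≢d i≢m = trans (agree i i≢d i≢m) (cong σ (sym (transp-fix i≢d i≢m)))

fun-injective : (π : S∞) → ∀ {a b} → fun π a ≡ fun π b → a ≡ b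
fun-injective π = Injection.injective (Inverse⇒Injection π)

AgreeOff-image : (σ ρ : S∞) {d m k : ℕ} → AgreeOff (fun ρ) (fun σ) d m →
                 k ≡ d ⊎ k ≡ m → fun ρ k ≡ fun σ d ⊎ fun ρ k ≡ fun σ m
AgreeOff-image σ ρ {d} {m} {k} agree k∈dm with inv σ (fun ρ k) ≟ d | inv σ (fun ρ k) ≟ m
... | yes j≡d | _       = inj₁ (trans (sym (Inverse.strictlyInverseˡ σ (fun ρ k))) (cong (fun σ) j≡d))
... | no _    | yes j≡m = inj₂ (trans (sym (Inverse.strictlyInverseˡ σ (fun ρ k))) (cong (fun σ) j≡m))
... | no j≢d  | no j≢m  = ⊥-elim ([ j≢d ∘ trans j≡k , j≢m ∘ trans j≡k ]′ k∈dm)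
  where
  j≡k : inv σ (fun ρ k) ≡ k
  j≡k = fun-injective ρ (trans (agree _ j≢d j≢m) (Inverse.strictlyInverseˡ σ (fun ρ k)))

AgreeOff⇒≗⊎≗∘transp : (σ ρ : S∞) {d m : ℕ} → d ≢ m → AgreeOff (fun ρ) (fun σ) d m →
                       fun ρ ≗ fun σ ⊎ fun ρ ≗ fun σ ∘ transp d m
AgreeOff⇒≗⊎≗∘transp σ ρ {d} {m} d≢m agree =
  classify (AgreeOff-image σ ρ agree (inj₁ refl)) (AgreeOff-image σ ρ agree (inj₂ refl))
  where
  s = fun σ
  r = fun ρ
  classify : r d ≡ s d ⊎ r d ≡ s m → r m ≡ s d ⊎ r m ≡ s m → r ≗ s ⊎ r ≗ s ∘ transp d m
  classify (inj₁ rd≡sd) (inj₂ rm≡sm) = inj₁ (AgreeOff⇒≗ agree rd≡sd rm≡sm)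
  classify (inj₂ rd≡sm) (inj₁ rm≡sd) = inj₂ (AgreeOff⇒≗ (AgreeOff-transp agree)
    (trans rd≡sm (cong s (sym (transp-fst d m)))) (trans rm≡sd (cong s (sym (transp-snd d≢m)))))
  classify (inj₁ rd≡sd) (inj₁ rm≡sd) = contradiction (fun-injective ρ (trans rd≡sd (sym rm≡sd))) d≢m
  classify (inj₂ rd≡sm) (inj₂ rm≡sm) = contradiction (fun-injective ρ (trans rd≡sm (sym rm≡sm))) d≢m

transp-⋖B : (σ : S∞) {d m : ℕ} → d < m → fun σ d < fun σ m →
            (∀ i → d < i → i < m → fun σ i < fun σ d ⊎ fun σ m < fun σ i) →
            fun σ ⋖B (fun σ ∘ transp d m)
transp-⋖B σ {d} {m} d<m σd<σm gap = transp-<B (fun σ) d<m σd<σm , nothing-between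
  where
  nothing-between : ∀ ρ → ¬ (fun σ <B fun ρ × fun ρ <B (fun σ ∘ transp d m))
  nothing-between ρ ((σ≤ρ , σ≢ρ) , (ρ≤τ , ρ≢τ)) =
    [ (λ ρ≗σ → σ≢ρ (sym ∘ ρ≗σ)) , ρ≢τ ]′
      (AgreeOff⇒≗⊎≗∘transp σ ρ (<⇒≢ d<m) (squeezed⇒AgreeOff d<m σd<σm σ≤ρ ρ≤τ gap))

rank<-past-first-difference : ∀ {σ ω d n x} → σ ≤B ω → (∀ i → i < d → σ i ≡ ω i) →
                              d < n → σ d ≤ x → x < ω d →
                              (∀ i → d < i → i < n → σ i < σ d ⊎ ω d < σ i) →
                              rank ω n x < rank σ n x
rank<-past-first-difference {σ} {ω} {d} {n} {x} σ≤ω agree d<n σd≤x x<ωd gap =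
  +-cancelʳ-≤ (window ω d) _ _ (begin
    suc (rank ω n x) + window ω d  ≡⟨ sym (+-suc (rank ω n x) (window ω d)) ⟩
    rank ω n x + suc (window ω d)  ≤⟨ +-monoʳ-≤ (rank ω n x) ω-window-grows ⟩
    rank ω n x + window ω n        ≡⟨ rank-split ω n x≤y ⟩
    rank ω n y                     ≤⟨ ≤B⇒rank≥ σ≤ω n y ⟩
    rank σ n y                     ≡⟨ sym (rank-split σ n x≤y) ⟩
    rank σ n x + window σ n        ≡⟨ cong (rank σ n x +_) (trans σ-window-frozen windows-agree) ⟩
    rank σ n x + window ω d        ∎)
  where
  open ≤-Reasoning
  y = ω d
  x≤y = <⇒≤ x<ωd
  window : (ℕ → ℕ) → ℕ → ℕ
  window π k = ∑[ i < k ] ⟦ π i ∈⟨ x , y ]⟧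
  ω-window-grows : suc (window ω d) ≤ window ω n
  ω-window-grows = subst (_≤ window ω n)
    (trans (cong (window ω d +_) (⟦∈⟨,]⟧-yes x<ωd ≤-refl)) (+-comm _ 1)) (∑<-mono-bound _ d<n)
  σ-off-window : ∀ i → d ≤ i → i < n → σ i ≤ x ⊎ y < σ i
  σ-off-window i d≤i i<n with m≤n⇒m<n∨m≡n d≤i
  ... | inj₂ refl = inj₁ σd≤x
  ... | inj₁ d<i  = Sum.map₁ (λ σi<σd → ≤-trans (<⇒≤ σi<σd) σd≤x) (gap i d<i i<n)
  σ-window-frozen : window σ n ≡ window σ d
  σ-window-frozen = ∑<-vanishing-tail _ (<⇒≤ d<n) λ i d≤i i<n → ⟦∈⟨,]⟧-no (σ-off-window i d≤i i<n)
  windows-agree : window σ d ≡ window ω d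
  windows-agree = ∑<-cong d λ i i<d → cong ⟦_∈⟨ x , y ]⟧ (agree i i<d)

transp-≤B : ∀ {σ ω d m} → σ ≤B ω → (∀ i → i < d → σ i ≡ ω i) → d < m → σ d < σ m → σ m ≤ ω d →
            (∀ i → d < i → i < m → σ i < σ d ⊎ ω d < σ i) → (σ ∘ transp d m) ≤B ω
transp-≤B {σ} {ω} {d} {m} σ≤ω agree d<m σd<σm σm≤ωd gap = rank≥⇒≤B ranks
  where
  ranks : ∀ n x → rank ω n x ≤ rank (σ ∘ transp d m) n x
  ranks n x with inside-or-outside σ d m n x
  ... | inj₂ outside = subst (rank ω n x ≤_) (sym (rank-transp-outside σ d<m (<⇒≤ σd<σm) outside))
                             (≤B⇒rank≥ σ≤ω n x)
  ... | inj₁ inside@((d<n , n≤m) , (σd≤x , x<σm)) = s≤s⁻¹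
    (subst (rank ω n x <_) (sym (rank-transp-inside σ d<m inside))
      (rank<-past-first-difference σ≤ω agree d<n σd≤x (<-≤-trans x<σm σm≤ωd)
        λ i d<i i<n → gap i d<i (<-≤-trans i<n n≤m)))

transp-≤B⇒< : (σ : S∞) {p q : ℕ} → p < q → fun σ ≤B (fun σ ∘ transp p q) → fun σ p < fun σ q
transp-≤B⇒< σ {p} {q} p<q σ≤τ = ≤∧≢⇒<
  (subst (fun σ p ≤_) (cong (fun σ) (transp-fst p q))
    (≤B-agree⇒≤ σ≤τ p λ i i<p → cong (fun σ) (sym (transp-fix-below p<q i<p))))
  (<⇒≢ p<q ∘ fun-injective σ)

transp-≤B⇒≤ : ∀ {σ ω p q} → (σ ∘ transp p q) ≤B ω → p < q → (∀ i → i < p → σ i ≡ ω i) → σ q ≤ ω p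
transp-≤B⇒≤ {σ} {ω} {p} {q} τ≤ω p<q agree = subst (_≤ ω p) (cong σ (transp-fst p q))
  (≤B-agree⇒≤ τ≤ω p λ i i<p → trans (cong σ (transp-fix-below p<q i<p)) (agree i i<p))

module _ {ℓ} {P : Pred ℕ ℓ} (P? : Decidable P) where

  minimise : ∀ n → (∀ j → j < n → ¬ P j) ⊎ Σ ℕ (λ m → P m × (∀ j → P j → m ≤ j))
  minimise zero = inj₁ λ _ ()
  minimise (suc n) with minimise n
  ... | inj₂ found = inj₂ found
  ... | inj₁ none with P? n
  ...   | yes Pn  = inj₂ (n , Pn , λ j Pj → ≮⇒≥ λ j<n → none j j<n Pj)
  ...   | no ¬Pn = inj₁ λ j j<1+n Pj →
    [ (λ j<n → none j j<n Pj) , (λ j≡n → ¬Pn (subst P j≡n Pj)) ]′ (m≤n⇒m<n∨m≡n (s≤s⁻¹ j<1+n))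

  least : ∀ {k} → P k → Σ ℕ (λ m → P m × (∀ j → P j → m ≤ j))
  least {k} Pk = [ (λ none → contradiction Pk (none k ≤-refl)) , id ]′ (minimise (suc k))

module FirstDifference (σ ω : S∞) (σ≤ω : fun σ ≤B fun ω) {d : ℕ} (isD : IsD σ ω d) where

  s w : ℕ → ℕ
  s = fun σ
  w = fun ω

  agree : ∀ i → i < d → s i ≡ w i
  agree = proj₂ isD

  σd<ωd : s d < w d
  σd<ωd = ≤∧≢⇒< (≤B-agree⇒≤ σ≤ω d agree) (proj₁ isD)

  f : ℕ
  f = fOf σ ω d

  σf≡ωd : s f ≡ w d
  σf≡ωd = Inverse.strictlyInverseˡ σ (w d)

  d<f : d < f
  d<f with <-cmp f d
  ... | tri< f<d _ _ = contradiction (fun-injective ω (trans (sym (agree f f<d)) σf≡ωd)) (<⇒≢ f<d)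
  ... | tri≈ _ f≡d _ = contradiction (trans (cong s (sym f≡d)) σf≡ωd) (proj₁ isD)
  ... | tri> _ _ d<f = d<f

  mCond? : Decidable (MCond σ d f)
  mCond? j = ((d <? j) ×-dec (j ≤? f)) ×-dec ((s d <? s j) ×-dec (s j ≤? s f))

  m-exists : Σ ℕ (IsM σ ω d)
  m-exists = least mCond? ((d<f , ≤-refl) , (subst (s d <_) (sym σf≡ωd) σd<ωd , ≤-refl))

  m : ℕ
  m = proj₁ m-exists

  isM : IsM σ ω d m
  isM = proj₂ m-exists

  minimal : ∀ j → MCond σ d f j → m ≤ j
  minimal = proj₂ isM

  d<m : d < m
  d<m = proj₁ (proj₁ (proj₁ isM))

  m≤f : m ≤ f
  m≤f = proj₂ (proj₁ (proj₁ isM))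

  σd<σm : s d < s m
  σd<σm = proj₁ (proj₂ (proj₁ isM))

  σm≤ωd : s m ≤ w d
  σm≤ωd = subst (s m ≤_) σf≡ωd (proj₂ (proj₂ (proj₁ isM)))

  gap : ∀ i → d < i → i < m → s i < s d ⊎ w d < s i
  gap i d<i i<m with <-cmp (s i) (s d)
  ... | tri< σi<σd _ _ = inj₁ σi<σd
  ... | tri≈ _ σi≡σd _ = contradiction (fun-injective σ σi≡σd) (≢-sym (<⇒≢ d<i))
  ... | tri> _ _ σd<σi = inj₂ (≰⇒> λ σi≤ωd → <⇒≱ i<m
    (minimal i ((d<i , ≤-trans (<⇒≤ i<m) m≤f) , (σd<σi , subst (s i ≤_) (sym σf≡ωd) σi≤ωd))))

  d≤candidate : ∀ {p q} → RelCand σ ω p q → d ≤ p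
  d≤candidate {p} {q} (p<q , ((σ≤τ , _) , _) , τ≤ω) = ≮⇒≥ λ p<d → <⇒≱ (transp-≤B⇒< σ p<q σ≤τ)
    (subst (s q ≤_) (sym (agree p p<d)) (transp-≤B⇒≤ τ≤ω p<q λ i i<p → agree i (<-trans i<p p<d)))

  lex-least : ∀ p q → RelCand σ ω p q → ¬ ((p , q) ≡ (d , m)) → (d , m) <lex (p , q)
  lex-least p q cand@(p<q , ((σ≤τ , _) , _) , τ≤ω) pq≢dm with m≤n⇒m<n∨m≡n (d≤candidate cand)
  ... | inj₁ d<p = inj₁ d<p
  ... | inj₂ refl with <-cmp m q
  ...   | tri< m<q _ _ = inj₂ (refl , m<q)
  ...   | tri≈ _ refl _ = contradiction refl pq≢dm
  ...   | tri> _ _ q<m = contradiction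
    (minimal q ((p<q , ≤-trans (<⇒≤ q<m) m≤f) ,
                (transp-≤B⇒< σ p<q σ≤τ , subst (s q ≤_) (sym σf≡ωd) (transp-≤B⇒≤ τ≤ω p<q agree))))
    (<⇒≱ q<m)

mainTheorem19 : (σ ω : S∞) → fun σ <B fun ω →
    (d : ℕ) → IsD σ ω d →
    Σ ℕ (λ m → IsM σ ω d m × RelCand σ ω d m
      × (∀ p q → RelCand σ ω p q → ¬ ((p , q) ≡ (d , m)) → (d , m) <lex (p , q)))
mainTheorem19 σ ω (σ≤ω , _) d isD = m , isM , (d<m , cover , bounded) , lex-least
  where
  open FirstDifference σ ω σ≤ω isD
  cover : fun σ ⋖B (fun σ ∘ transp d m)
  cover = transp-⋖B σ d<m σd<σm λ i d<i i<m → Sum.map₂ (≤-<-trans σm≤ωd) (gap i d<i i<m)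
  bounded : (fun σ ∘ transp d m) ≤B fun ω
  bounded = transp-≤B σ≤ω agree d<m σd<σm σm≤ωd gap
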